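{- Let $d\ge 10$ be an integer, let $p\ge d$ be a prime with $p\equiv 3\pmod 8$ if $d$ is even, let $\kappa=\log_d p$, let $q>\max\{p^8,120^\kappa p\}$ be a prime, and let $G_{d,p,q}$ be as in the context. If $p$ is not a quadratic residue modulo $q$, then $G_{d,p,q}$ is bipartite. If $p$ is a quadratic residue modulo $q$ and $G_{d,p,q}$ is connected, then $G_{d,p,q}$ is not bipartite.
   Context: $\mathbb H(\mathbb Z)$ denotes the Hamilton integral quaternions ($i^2=j^2=k^2=-1$, $k=ij=-ji$); for $\alpha=a_0+a_1i+a_2j+a_3k$, $\bar\alpha=a_0-a_1i-a_2j-a_3k$, $N(\alpha)=a_0^2+a_1^2+a_2^2+a_3^2$, and $\alpha$ is primitive if $\gcd(a_0,\dots,a_3)=1$. For odd prime $p$: if $p\equiv1\pmod4$, $\mathcal P(p)$ is the set of primitive $\pi$ with $N(\pi)=p$, $\pi_0>0$, $\pi-1\in2\mathbb H(\mathbb Z)$; if $p\equiv3\pmod4$, $\mathcal P(p)$ is the set of primitive $\pi$ with $N(\pi)=p$, $\pi_0>0$ if $\pi_0\ne0$ or $\pi_1>0$ if $\pi_0=0$, and $\pi-i-j-k\in2\mathbb H(\mathbb Z)$. $D(d)\subset\mathcal P(p)$ is a subset of cardinality $d+1$ such that for each $\pi\in D(d)$, $\bar\pi\in D(d)$ iff $\bar\pi\in\mathcal P(p)$. Fix $x,y\in\mathbb F_q$ with $x^2+y^2+1=0$ and let $\phi:\mathbb H(\mathbb F_q)\to M_2(\mathbb F_q)$ be the algebra isomorphism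 $\alpha_0+\alpha_1i+\alpha_2j+\alpha_3k\mapsto\begin{pmatrix}\alpha_0+\alpha_1x+\alpha_3y & -\alpha_1y+\alpha_2+\alpha_3x\\ -\alpha_1y-\alpha_2+\alpha_3x & \alpha_0-\alpha_1x-\alpha_3y\end{pmatrix}$. For $\alpha\in\mathbb H(\mathbb Z)$ with $q\nmid N(\alpha)$, $\bar\mu_q(\alpha)$ is the class in $PGL_2(\mathbb F_q)$ of $\phi(\alpha\bmod q)$. Put $D_{p,q}=\bar\mu_q(D(d))$. Define $G_{d,p,q}=\mathrm{Cay}(PGL_2(\mathbb F_q),D_{p,q})$ if $p$ is not a quadratic residue mod $q$, and $G_{d,p,q}=\mathrm{Cay}(PSL_2(\mathbb F_q),D_{p,q})$ if it is (in which case $D_{p,q}\subset PSL_2(\mathbb F_q)$). Here $\mathrm{Cay}(H,S)$ is the graph with vertex set $H$ in which $g$ is adjacent to $gs$ for $s\in S$. -}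

module Defs where

open import Data.Nat as ℕ using (ℕ)
open import Data.Nat.Primality using (Prime)
open import Data.Integer as ℤ using (ℤ; +_; _+_; _-_; _*_; -_; ∣_∣)
open import Data.Integer.Divisibility using (_∣_)
open import Data.Bool using (Bool)
open import Data.List using (List; map; length)
open import Data.List.Membership.Propositional using (_∈_)
open import Data.List.Relation.Unary.All using (All)
open import Data.List.Relation.Unary.Unique.Propositional using (Unique)
open import Data.Product using (Σ; ∃; _×_; ∃-syntax)
open import Data.Sum using (_⊎_)
open import Relation.Nullary using (¬_)
open import Relation.Binary.PropositionalEquality using (_≡_)

record Quat : Set where
  constructor quat
  field
    a₀ a₁ a₂ a₃ : ℤ
open Quat public

conj : Quat → Quat
conj (quat a b c d) = quat a (- b) (- c) (- d)

norm : Quat → ℤ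
norm (quat a b c d) = a * a + b * b + c * c + d * d

Primitive : Quat → Set
Primitive (quat a b c d) =
  ∀ (k : ℕ) → (+ k) ∣ a → (+ k) ∣ b → (+ k) ∣ c → (+ k) ∣ d → k ≡ 1

Even : ℤ → Set
Even z = (+ 2) ∣ z

InP : ℕ → Quat → Set
InP p π@(quat a b c d) =
  Primitive π × norm π ≡ + p ×
  ( (p ℕ.% 4 ≡ 1 × ℤ.+0 ℤ.< a × Even (a - + 1) × Even b × Even c × Even d)
  ⊎ (p ℕ.% 4 ≡ 3
     × ((¬ (a ≡ ℤ.+0) × ℤ.+0 ℤ.< a) ⊎ (a ≡ ℤ.+0 × ℤ.+0 ℤ.< b))
     × Even a × Even (b - + 1) × Even (c - + 1) × Even (d - + 1)) )

IsD : ℕ → ℕ → List Quat → Set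
IsD d p D =
  Unique D × length D ≡ ℕ.suc d × All (InP p) D ×
  (∀ π → π ∈ D → (conj π ∈ D → InP p (conj π)) × (InP p (conj π) → conj π ∈ D))

-- Arithmetic modulo q (F_q represented by ℤ up to congruence)

infix 4 _≡[_]_ _∼[_]_
_≡[_]_ : ℤ → ℕ → ℤ → Set
a ≡[ q ] b = (+ q) ∣ (a - b)

QR : ℤ → ℕ → Set
QR r q = ¬ (r ≡[ q ] ℤ.+0) × ∃[ t ] (t * t ≡[ q ] r)

-- 2×2 integer matrices, read modulo q

record M2 : Set where
  constructor mat
  field
    m₀₀ m₀₁ m₁₀ m₁₁ : ℤ
open M2 public

_⊗_ : M2 → M2 → M2
mat a b c d ⊗ mat e f g h =
  mat (a * e + b * g) (a * f + b * h) (c * e + d * g) (c * f + d * h)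

det : M2 → ℤ
det (mat a b c d) = a * d - b * c

-- the isomorphism φ : H(F_q) → M₂(F_q) (with x² + y² + 1 ≡ 0 mod q), applied to α mod q
φ : ℤ → ℤ → Quat → M2
φ x y (quat a₀ a₁ a₂ a₃) =
  mat (a₀ + a₁ * x + a₃ * y) (- (a₁ * y) + a₂ + a₃ * x)
      (- (a₁ * y) - a₂ + a₃ * x) (a₀ - a₁ * x - a₃ * y)

_∼[_]_ : M2 → ℕ → M2 → Set
A ∼[ q ] B = ∃[ λ' ] (¬ (λ' ≡[ q ] ℤ.+0) ×
  m₀₀ A ≡[ q ] (λ' * m₀₀ B) × m₀₁ A ≡[ q ] (λ' * m₀₁ B) ×
  m₁₀ A ≡[ q ] (λ' * m₁₀ B) × m₁₁ A ≡[ q ] (λ' * m₁₁ B))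

-- vertex sets: representatives of PGL₂(F_q), resp. of PSL₂(F_q)
-- (the image of SL₂ in PGL₂ = classes with square determinant)
InPGL : ℕ → M2 → Set
InPGL q A = ¬ (det A ≡[ q ] ℤ.+0)

InPSL : ℕ → M2 → Set
InPSL q A = QR (det A) q

Adj : ℕ → List M2 → M2 → M2 → Set
Adj q S A B = ∃[ s ] (s ∈ S × ((B ∼[ q ] (A ⊗ s)) ⊎ (A ∼[ q ] (B ⊗ s))))

Bipartite : ℕ → (M2 → Set) → List M2 → Set
Bipartite q V S = Σ (M2 → Bool) λ c → (
  (∀ A B → V A → V B → A ∼[ q ] B → c A ≡ c B) ×
  (∀ A B → V A → V B → Adj q S A B → ¬ (c A ≡ c B)))

data Reach (q : ℕ) (V : M2 → Set) (S : List M2) (A : M2) : M2 → Set where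
  base : ∀ {B} → A ∼[ q ] B → Reach q V S A B
  step : ∀ {B C} → Reach q V S A B → V C → Adj q S B C → Reach q V S A C

Connected : ℕ → (M2 → Set) → List M2 → Set
Connected q V S = ∀ A B → V A → V B → Reach q V S A B

-- q > 120^κ · p with κ = log_d p, expressed without reals:
-- equivalent to ∃ a rational m/n with log_d p < m/n < log_120 (q/p).
LogCond : ℕ → ℕ → ℕ → Set
LogCond d p q = ∃[ m ] ∃[ n ] (0 ℕ.< n × p ℕ.^ n ℕ.< d ℕ.^ m ×
  120 ℕ.^ m ℕ.* p ℕ.^ n ℕ.< q ℕ.^ n)

-- Colour a matrix by whether its determinant is a square mod q. Every
-- generator φ(π) has determinant N(π) = p mod q, and for the odd prime q the
-- product of two non-squares is a square (by a pigeonhole count). So when p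
-- is a non-residue the colour changes along every edge of the Cayley graph
-- on PGL₂(F_q).
--
-- When p is a residue, the generators lie in PSL₂(F_q). Left multiplication by
-- G is a graph automorphism, so in a connected graph a proper 2-colouring c
-- satisfies c(GA) xor c(A) = c(G) xor c(1); hence every square, and every
-- product of squares, has the colour of 1. Every element of PSL₂(F_q) is such
-- a product, being up to scaling a product of unipotent matrices U(w) and L(w)
-- with U(w) = U(w/2)². A generator s would then have the colour of its
-- neighbour 1.

module Submission where

open import Defs
open import Data.Nat using (ℕ; _≤_; _<_; _^_; _%_)
open import Data.Nat.Primality using (Prime)
open import Data.Integer using (ℤ; +_; _+_; _*_)
open import Data.List using (List; map)
open import Data.Product using (_×_)
open import Relation.Nullary using (¬_)
open import Relation.Binary.PropositionalEquality using (_≡_)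

open import Data.Bool using (Bool; true; false; not; _xor_)
open import Data.Bool.Properties using (¬-not; not-distribˡ-xor; not-distribʳ-xor; not-involutive)
open import Data.Empty using (⊥; ⊥-elim)
open import Data.Fin using (Fin; toℕ; fromℕ<)
open import Data.Fin.Properties using (any?; toℕ<n; toℕ-fromℕ<; pigeonhole)
open import Data.Integer using (0ℤ; 1ℤ; _-_; -_; ∣_∣)
open import Data.Integer.DivMod using (_%ℕ_; _/ℕ_; n%ℕd<d; a≡a%ℕn+[a/ℕn]*n)
import Data.Integer.Divisibility.Signed as ℤ
import Data.Integer.Properties as Int
open import Data.Integer.Tactic.RingSolver using (solve-∀)
open import Data.List using (_∷_; [])
open import Data.List.Membership.Propositional using (_∈_)
open import Data.List.Membership.Propositional.Properties using (∈-map⁻)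
open import Data.List.Relation.Unary.All as All using (All)
open import Data.List.Relation.Unary.Any using (here)
open import Data.Nat as ℕ using (zero; suc; NonZero)
import Data.Nat.Divisibility as ℕ
open import Data.Nat.Coprimality using (Coprime; coprime-Bézout)
open import Data.Nat.GCD using (module Bézout)
open import Data.Nat.Primality using (prime⇒irreducible; prime⇒nonZero; prime⇒nonTrivial; euclidsLemma)
import Data.Nat.Properties as ℕ
open import Data.Product using (_,_; proj₁; proj₂; ∃-syntax)
open import Data.Sum using (_⊎_; inj₁; inj₂)
open import Function using (_∘_)
open import Function.Bundles using (mk⇔)
open import Relation.Binary.Bundles using (Setoid)
open import Relation.Binary.PropositionalEquality
  using (_≢_; refl; sym; trans; cong; cong₂; subst; module ≡-Reasoning)
import Relation.Binary.Reasoning.Setoid as SetoidReasoning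
open import Relation.Binary.Structures using (IsEquivalence)
open import Relation.Nullary using (Dec; yes; no; does)
open import Relation.Nullary.Decidable using (does-⇔)

module PrimeField (q : ℕ) (q-prime : Prime q) where

  instance
    q≢0 : NonZero q
    q≢0 = prime⇒nonZero q-prime

  q∣_ : ℤ → Set
  q∣ z = + q ℤ.∣ z

  q∤_ : ℤ → Set
  q∤ z = ¬ q∣ z

  q∣-multiple : ∀ k → q∣ (k * + q)
  q∣-multiple k = ℤ.divides k refl

  -- Every congruence is proved by exhibiting its left side as an integer
  -- combination of expressions already known to vanish mod q; the ring
  -- solver checks the combination.
  q∣-lincomb₁ : ∀ {X e} k → X ≡ k * e → q∣ e → q∣ X
  q∣-lincomb₁ k eq q∣e = subst q∣_ (sym eq) (ℤ.∣n⇒∣m*n k q∣e)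

  q∣-lincomb₂ : ∀ {X e f} k l → X ≡ k * e + l * f → q∣ e → q∣ f → q∣ X
  q∣-lincomb₂ k l eq q∣e q∣f =
    subst q∣_ (sym eq) (ℤ.∣m∣n⇒∣m+n (ℤ.∣n⇒∣m*n k q∣e) (ℤ.∣n⇒∣m*n l q∣f))

  q∣-lincomb₄ : ∀ {X e f g h} k l m n → X ≡ k * e + l * f + m * g + n * h →
                q∣ e → q∣ f → q∣ g → q∣ h → q∣ X
  q∣-lincomb₄ k l m n eq q∣e q∣f q∣g q∣h =
    subst q∣_ (sym eq) (ℤ.∣m∣n⇒∣m+n (ℤ.∣m∣n⇒∣m+n (q∣-lincomb₂ k l refl q∣e q∣f) (ℤ.∣n⇒∣m*n m q∣g))
                                   (ℤ.∣n⇒∣m*n n q∣h))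

  q∣-swap : ∀ {a b} → q∣ (a - b) → q∣ (b - a)
  q∣-swap {a} {b} = q∣-lincomb₁ (- 1ℤ) (swap a b)
    where swap : ∀ a b → b - a ≡ - 1ℤ * (a - b)
          swap = solve-∀

  q∣? : ∀ z → Dec (q∣ z)
  q∣? z = + q ℤ.∣? z

  q∣-small : ∀ {z} → ∣ z ∣ ℕ.< q → q∣ z → z ≡ 0ℤ
  q∣-small {z} ∣z∣<q q∣z with ∣ z ∣ in ∣z∣≡n
  ... | zero  = Int.∣i∣≡0⇒i≡0 ∣z∣≡n
  ... | suc n = ⊥-elim (ℕ.>⇒∤ ∣z∣<q (subst (q ℕ.∣_) ∣z∣≡n (ℤ.∣⇒∣ᵤ q∣z)))

  q∤-small : ∀ {n} → 0 < n → n < q → q∤ (+ n)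
  q∤-small {suc n} _ n<q q∣n with q∣-small n<q q∣n
  ... | ()

  q∣-refl : ∀ a → q∣ (a - a)
  q∣-refl a = subst q∣_ (sym (Int.+-inverseʳ a)) (q∣-multiple 0ℤ)

  q∤1 : q∤ 1ℤ
  q∤1 = q∤-small (ℕ.s≤s ℕ.z≤n) (ℕ.nonTrivial⇒n>1 q {{prime⇒nonTrivial q-prime}})

  q∣*⇒q∣⊎q∣ : ∀ a b → q∣ (a * b) → q∣ a ⊎ q∣ b
  q∣*⇒q∣⊎q∣ a b q∣ab
    with euclidsLemma ∣ a ∣ ∣ b ∣ q-prime (subst (q ℕ.∣_) (Int.abs-* a b) (ℤ.∣⇒∣ᵤ q∣ab))
  ... | inj₁ q∣a = inj₁ (ℤ.∣ᵤ⇒∣ q∣a)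
  ... | inj₂ q∣b = inj₂ (ℤ.∣ᵤ⇒∣ q∣b)

  q∤-* : ∀ {a b} → q∤ a → q∤ b → q∤ (a * b)
  q∤-* {a} {b} q∤a q∤b q∣ab with q∣*⇒q∣⊎q∣ a b q∣ab
  ... | inj₁ q∣a = q∤a q∣a
  ... | inj₂ q∣b = q∤b q∣b

  q∣-reduce : ∀ t → q∣ (t - + (t %ℕ q))
  q∣-reduce t = subst q∣_ (sym (cancel {s = t /ℕ q} (a≡a%ℕn+[a/ℕn]*n t q))) (q∣-multiple (t /ℕ q))
    where
      cancel : ∀ {t r s} → t ≡ r + s * + q → t - r ≡ s * + q
      cancel {r = r} {s} refl = identity r s (+ q)
        where identity : ∀ r s Q → r + s * Q - r ≡ s * Q
              identity = solve-∀

  ≡-residue⇒q∣ : ∀ {u v} → u %ℕ q ≡ v %ℕ q → q∣ (u - v)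
  ≡-residue⇒q∣ {u} {v} u%q≡v%q = q∣-lincomb₂ 1ℤ (- 1ℤ) (identity u v (+ (v %ℕ q)))
    (subst (λ r → q∣ (u - + r)) u%q≡v%q (q∣-reduce u)) (q∣-reduce v)
    where identity : ∀ u v r → u - v ≡ 1ℤ * (u - r) + - 1ℤ * (v - r)
          identity = solve-∀

  private
    bézout-inverse : ∀ {m} → ¬ q ℕ.∣ m → ∃[ b ] q∣ (+ m * b - 1ℤ)
    bézout-inverse {m} q∤m with coprime-Bézout coprime
      where
        coprime : Coprime m q
        coprime (d∣m , d∣q) with prime⇒irreducible q-prime d∣q
        ... | inj₁ d≡1 = d≡1
        ... | inj₂ refl = ⊥-elim (q∤m d∣m)
    ... | Bézout.+- x y 1+yq≡xm = + x , subst q∣_ (sym (begin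
      + m * + x - 1ℤ              ≡⟨ cong (_- 1ℤ) (sym (Int.pos-* m x)) ⟩
      + (m ℕ.* x) - 1ℤ            ≡⟨ cong (λ t → + t - 1ℤ) (trans (ℕ.*-comm m x) (sym 1+yq≡xm)) ⟩
      + (1 ℕ.+ y ℕ.* q) - 1ℤ      ≡⟨ cong (_- 1ℤ) (Int.pos-+ 1 (y ℕ.* q)) ⟩
      1ℤ + + (y ℕ.* q) - 1ℤ       ≡⟨ identity (+ (y ℕ.* q)) ⟩
      + (y ℕ.* q)                 ≡⟨ Int.pos-* y q ⟩
      + y * + q                   ∎)) (q∣-multiple (+ y))
      where
        open ≡-Reasoning
        identity : ∀ z → 1ℤ + z - 1ℤ ≡ z
        identity = solve-∀
    ... | Bézout.-+ x y 1+xm≡yq = - + x , subst q∣_ (sym (begin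
      + m * - + x - 1ℤ            ≡⟨ identity (+ m) (+ x) ⟩
      - (1ℤ + + x * + m)          ≡⟨ cong (λ t → - (1ℤ + t)) (sym (Int.pos-* x m)) ⟩
      - (+ (1 ℕ.+ x ℕ.* m))       ≡⟨ cong (λ t → - + t) 1+xm≡yq ⟩
      - (+ (y ℕ.* q))             ≡⟨ cong -_ (Int.pos-* y q) ⟩
      - (+ y * + q)               ≡⟨ Int.neg-distribˡ-* (+ y) (+ q) ⟩
      - + y * + q                 ∎)) (q∣-multiple (- + y))
      where
        open ≡-Reasoning
        identity : ∀ m x → m * - x - 1ℤ ≡ - (1ℤ + x * m)
        identity = solve-∀

  inverse : ∀ {a} → q∤ a → ∃[ b ] q∣ (a * b - 1ℤ)
  inverse {a} q∤a with Int.+∣i∣≡i⊎+∣i∣≡-i a | bézout-inverse {∣ a ∣} (λ q∣a → q∤a (ℤ.∣ᵤ⇒∣ q∣a))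
  ... | inj₁ +∣a∣≡a  | b , q∣∣a∣b-1 = b , subst (λ t → q∣ (t * b - 1ℤ)) +∣a∣≡a q∣∣a∣b-1
  ... | inj₂ +∣a∣≡-a | b , q∣∣a∣b-1 =
    - b , subst q∣_ (trans (cong (λ t → t * b - 1ℤ) +∣a∣≡-a) (negate a b)) q∣∣a∣b-1
    where negate : ∀ a b → - a * b - 1ℤ ≡ a * - b - 1ℤ
          negate = solve-∀

  q∤-inverse : ∀ a b → q∣ (a * b - 1ℤ) → q∤ b
  q∤-inverse a b q∣ab-1 q∣b = q∤1 (q∣-lincomb₂ a (- 1ℤ) (identity a b) q∣b q∣ab-1)
    where identity : ∀ a b → 1ℤ ≡ a * b + - 1ℤ * (a * b - 1ℤ)
          identity = solve-∀

  IsSquare : ℤ → Set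
  IsSquare r = ∃[ t ] q∣ (t * t - r)

  IsResidue : ℤ → Set
  IsResidue r = q∤ r × IsSquare r

  isSquare? : ∀ r → Dec (IsSquare r)
  isSquare? r with any? (λ (k : Fin q) → q∣? (+ toℕ k * + toℕ k - r))
  ... | yes (k , q∣k²-r) = yes (+ toℕ k , q∣k²-r)
  ... | no ¬k²≡r = no λ (t , q∣t²-r) → ¬k²≡r (residue t ,
          subst (λ k → q∣ (+ k * + k - r)) (sym (toℕ-fromℕ< (n%ℕd<d t q)))
            (congruent-square {t} (q∣-reduce t) q∣t²-r))
    where
      residue : ℤ → Fin q
      residue t = fromℕ< (n%ℕd<d t q)
      congruent-square : ∀ {t k} → q∣ (t - k) → q∣ (t * t - r) → q∣ (k * k - r)
      congruent-square {t} {k} q∣t-k q∣t²-r =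
        q∣-lincomb₂ 1ℤ (- (t + k)) (identity t k r) q∣t²-r q∣t-k
        where identity : ∀ t k r → k * k - r ≡ 1ℤ * (t * t - r) + - (t + k) * (t - k)
              identity = solve-∀

  q∤-root : ∀ r t → q∤ r → q∣ (t * t - r) → q∤ t
  q∤-root r t q∤r q∣t²-r q∣t = q∤r (q∣-lincomb₂ t (- 1ℤ) (identity r t) q∣t q∣t²-r)
    where identity : ∀ r t → r ≡ t * t + - 1ℤ * (t * t - r)
          identity = solve-∀

  square-scale : ∀ r k s → q∣ (r - k * k * s) → IsSquare s → IsSquare r
  square-scale r k s q∣r-k²s (t , q∣t²-s) =
    k * t , q∣-lincomb₂ (k * k) (- 1ℤ) (identity r k s t) q∣t²-s q∣r-k²s
    where identity : ∀ r k s t → k * t * (k * t) - r ≡ k * k * (t * t - s) + - 1ℤ * (r - k * k * s)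
          identity = solve-∀

  square-unscale : ∀ r k s → q∤ k → q∣ (r - k * k * s) → IsSquare r → IsSquare s
  square-unscale r k s q∤k q∣r-k²s r-square with inverse q∤k
  ... | k⁻¹ , q∣kk⁻¹-1 = square-scale s k⁻¹ r
    (q∣-lincomb₂ (- (k⁻¹ * k⁻¹)) (- (s * (k⁻¹ * k + 1ℤ))) (identity r k s k⁻¹) q∣r-k²s q∣kk⁻¹-1) r-square
    where identity : ∀ r k s i → s - i * i * r ≡
                       - (i * i) * (r - k * k * s) + - (s * (i * k + 1ℤ)) * (k * i - 1ℤ)
          identity = solve-∀

  q∤-scale : ∀ r k s → q∣ (r - k * k * s) → q∤ k → q∤ s → q∤ r
  q∤-scale r k s q∣r-k²s q∤k q∤s q∣r =
    q∤-* (q∤-* q∤k q∤k) q∤s (q∣-lincomb₂ 1ℤ (- 1ℤ) (identity r k s) q∣r q∣r-k²s)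
    where identity : ∀ r k s → k * k * s ≡ 1ℤ * r + - 1ℤ * (r - k * k * s)
          identity = solve-∀

  residue-scale : ∀ r k s → q∣ (r - k * k * s) → q∤ k → IsResidue s → IsResidue r
  residue-scale r k s q∣r-k²s q∤k (q∤s , s-square) =
    q∤-scale r k s q∣r-k²s q∤k q∤s , square-scale r k s q∣r-k²s s-square

  residue-congruent : ∀ r s → q∣ (r - s) → IsResidue s → IsResidue r
  residue-congruent r s q∣r-s =
    residue-scale r 1ℤ s (subst (λ t → q∣ (r - t)) (sym (Int.*-identityˡ s)) q∣r-s) q∤1

  residue-* : ∀ {a b} → IsResidue a → IsResidue b → IsResidue (a * b)
  residue-* {a} {b} (q∤a , t , q∣t²-a) (q∤b , u , q∣u²-b) =
    q∤-* q∤a q∤b , t * u , q∣-lincomb₂ (u * u) a (identity t u a b) q∣t²-a q∣u²-b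
    where identity : ∀ t u a b → t * u * (t * u) - a * b ≡ u * u * (t * t - a) + a * (u * u - b)
          identity = solve-∀

  residue? : ∀ r → Dec (IsResidue r)
  residue? r with q∣? r | isSquare? r
  ... | yes q∣r | _            = no λ (q∤r , _) → q∤r q∣r
  ... | no q∤r  | yes r-square = yes (q∤r , r-square)
  ... | no _    | no r-nonsquare = no λ (_ , r-square) → r-nonsquare r-square

  ≡[q]⇒q∣ : ∀ a b → a ≡[ q ] b → q∣ (a - b)
  ≡[q]⇒q∣ a b = ℤ.∣ᵤ⇒∣

  q∣⇒≡[q] : ∀ a b → q∣ (a - b) → a ≡[ q ] b
  q∣⇒≡[q] a b = ℤ.∣⇒∣ᵤ

  ≢[q]0⇒q∤ : ∀ {a} → ¬ (a ≡[ q ] 0ℤ) → q∤ a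
  ≢[q]0⇒q∤ {a} a≢0 q∣a = a≢0 (q∣⇒≡[q] a 0ℤ (subst q∣_ (sym (Int.+-identityʳ a)) q∣a))

  q∤⇒≢[q]0 : ∀ {a} → q∤ a → ¬ (a ≡[ q ] 0ℤ)
  q∤⇒≢[q]0 {a} q∤a a≡0 = q∤a (subst q∣_ (Int.+-identityʳ a) (≡[q]⇒q∣ a 0ℤ a≡0))

  QR⇒IsResidue : ∀ {r} → QR r q → IsResidue r
  QR⇒IsResidue {r} (r≢0 , t , t²≡r) = ≢[q]0⇒q∤ r≢0 , t , ≡[q]⇒q∣ (t * t) r t²≡r

  IsResidue⇒QR : ∀ {r} → IsResidue r → QR r q
  IsResidue⇒QR {r} (q∤r , t , q∣t²-r) = q∤⇒≢[q]0 q∤r , t , q∣⇒≡[q] (t * t) r q∣t²-r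

odd-prime : ∀ {q} → Prime q → 2 < q → ∃[ h ] q ≡ suc (h ℕ.+ h)
odd-prime {q} q-prime 2<q with parity q
  where
    parity : ∀ n → ∃[ h ] (n ≡ h ℕ.+ h ⊎ n ≡ suc (h ℕ.+ h))
    parity zero = 0 , inj₁ refl
    parity (suc n) with parity n
    ... | h , inj₁ refl = h , inj₂ refl
    ... | h , inj₂ refl = suc h , inj₁ (cong suc (sym (ℕ.+-suc h h)))
... | h , inj₂ q≡1+2h = h , q≡1+2h
... | h , inj₁ refl
  with prime⇒irreducible q-prime (ℕ.divides h 2h≡h*2)
  where 2h≡h*2 : h ℕ.+ h ≡ h ℕ.* 2
        2h≡h*2 = trans (cong (h ℕ.+_) (sym (ℕ.+-identityʳ h))) (ℕ.*-comm 2 h)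
...   | inj₂ 2≡q = ⊥-elim (ℕ.<-irrefl 2≡q 2<q)

module QuadraticResidues (q : ℕ) (q-prime : Prime q) (2<q : 2 < q) where
  open PrimeField q q-prime

  private module Pigeonhole (h : ℕ) (q≡1+2h : q ≡ suc (h ℕ.+ h)) where
    sum<q : ∀ {x y} → x ≤ h → y ≤ h → x ℕ.+ y < q
    sum<q x≤h y≤h = subst (_ <_) (sym q≡1+2h) (ℕ.s≤s (ℕ.+-mono-≤ x≤h y≤h))

    q∤-in-range : ∀ {x} → 1 ≤ x → x ≤ h → q∤ (+ x)
    q∤-in-range 1≤x x≤h = q∤-small 1≤x (ℕ.≤-trans (ℕ.m≤m+n _ 0) (sum<q x≤h ℕ.z≤n))

    squares-distinct : ∀ {x y} → 1 ≤ x → x ≤ h → y ≤ h →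
                       q∣ (+ x * + x - + y * + y) → x ≡ y
    squares-distinct {x} {y} 1≤x x≤h y≤h q∣x²-y²
      with q∣*⇒q∣⊎q∣ (+ x - + y) (+ x + + y) (subst q∣_ (factor (+ x) (+ y)) q∣x²-y²)
      where factor : ∀ x y → x * x - y * y ≡ (x - y) * (x + y)
            factor = solve-∀
    ... | inj₁ q∣x-y = Int.+-injective (Int.i-j≡0⇒i≡j (+ x) (+ y)
          (q∣-small (ℕ.≤-<-trans (Int.∣i-j∣≤∣i∣+∣j∣ (+ x) (+ y)) (sum<q x≤h y≤h)) q∣x-y))
    ... | inj₂ q∣x+y = ⊥-elim (q∤-small (ℕ.≤-trans 1≤x (ℕ.m≤m+n x y)) (sum<q x≤h y≤h)
          (subst q∣_ (sym (Int.pos-+ x y)) q∣x+y))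

    module _ {a b} (q∤a : q∤ a) (q∤b : q∤ b) (a-nonsquare : ¬ IsSquare a)
             (b-nonsquare : ¬ IsSquare b) (ab-nonsquare : ¬ IsSquare (a * b)) where

      -- The q + 1 numbers 0, 1², …, h², a·1², …, a·h², b: pairwise incongruent
      -- when a, b and ab are non-squares, contradicting the pigeonhole principle.
      data Slot (i : ℕ) : Set where
        origin      : i ≡ 0 → Slot i
        square      : ∀ x → 1 ≤ x → x ≤ h → i ≡ x → Slot i
        a-square    : ∀ x → 1 ≤ x → x ≤ h → i ≡ h ℕ.+ x → Slot i
        last        : i ≡ suc (h ℕ.+ h) → Slot i

      slot : ∀ i → i < suc (suc (h ℕ.+ h)) → Slot i
      slot zero    _ = origin refl
      slot (suc k) k<2+2h with k ℕ.<? h | k ℕ.<? h ℕ.+ h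
      ... | yes k<h | _ = square (suc k) (ℕ.s≤s ℕ.z≤n) k<h refl
      ... | no k≮h | yes k<2h = a-square (suc (k ℕ.∸ h)) (ℕ.s≤s ℕ.z≤n)
              (ℕ.+-cancelˡ-< h _ _ (subst (_< h ℕ.+ h) (sym h+[k∸h]≡k) k<2h))
              (sym (trans (ℕ.+-suc h (k ℕ.∸ h)) (cong suc h+[k∸h]≡k)))
        where h+[k∸h]≡k : h ℕ.+ (k ℕ.∸ h) ≡ k
              h+[k∸h]≡k = ℕ.m+[n∸m]≡n (ℕ.≮⇒≥ k≮h)
      ... | no _ | no k≮2h = last (cong suc (ℕ.≤-antisym (ℕ.≤-pred (ℕ.≤-pred k<2+2h)) (ℕ.≮⇒≥ k≮2h)))

      value : ∀ {i} → Slot i → ℤ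
      value (origin _)         = 0ℤ
      value (square x _ _ _)   = + x * + x
      value (a-square x _ _ _) = a * (+ x * + x)
      value (last _)           = b

      record Apart (u v : ℤ) : Set where
        constructor apart
        field incongruent : q∤ (u - v)
      open Apart

      apart-sym : ∀ {u v} → Apart u v → Apart v u
      apart-sym {u} {v} u≉v = apart λ q∣v-u → incongruent u≉v (q∣-swap {v} {u} q∣v-u)

      apart-0 : ∀ {u} → q∤ u → Apart u 0ℤ
      apart-0 {u} q∤u = apart λ q∣u-0 → q∤u (subst q∣_ (Int.+-identityʳ u) q∣u-0)

      square≉0 : ∀ {x} → 1 ≤ x → x ≤ h → Apart (+ x * + x) 0ℤ
      square≉0 1≤x x≤h = apart-0 (q∤-* (q∤-in-range 1≤x x≤h) (q∤-in-range 1≤x x≤h))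

      a-square≉0 : ∀ {x} → 1 ≤ x → x ≤ h → Apart (a * (+ x * + x)) 0ℤ
      a-square≉0 1≤x x≤h = apart-0 (q∤-* q∤a (q∤-* (q∤-in-range 1≤x x≤h) (q∤-in-range 1≤x x≤h)))

      square≉a-square : ∀ x {y} → 1 ≤ y → y ≤ h → Apart (+ x * + x) (a * (+ y * + y))
      square≉a-square x {y} 1≤y y≤h with inverse (q∤-in-range 1≤y y≤h)
      ... | y⁻¹ , q∣yy⁻¹-1 = apart λ q∣x²-ay² → a-nonsquare (+ x * y⁻¹ ,
            q∣-lincomb₂ (y⁻¹ * y⁻¹) (a * (+ y * y⁻¹ + 1ℤ)) (identity (+ x) (+ y) y⁻¹ a) q∣x²-ay² q∣yy⁻¹-1)
        where identity : ∀ x y i a → x * i * (x * i) - a ≡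
                           i * i * (x * x - a * (y * y)) + a * (y * i + 1ℤ) * (y * i - 1ℤ)
              identity = solve-∀

      square≉b : ∀ x → Apart (+ x * + x) b
      square≉b x = apart λ q∣x²-b → b-nonsquare (+ x , q∣x²-b)

      a-square≉b : ∀ x → Apart (a * (+ x * + x)) b
      a-square≉b x = apart λ q∣ax²-b → ab-nonsquare (a * + x , q∣-lincomb₁ a (identity a (+ x) b) q∣ax²-b)
        where identity : ∀ a x b → a * x * (a * x) - a * b ≡ a * (a * (x * x) - b)
              identity = solve-∀

      a-squares-distinct : ∀ {x y} → 1 ≤ x → x ≤ h → y ≤ h →
                           q∣ (a * (+ x * + x) - a * (+ y * + y)) → x ≡ y
      a-squares-distinct {x} {y} 1≤x x≤h y≤h q∣ax²-ay²
        with q∣*⇒q∣⊎q∣ a (+ x * + x - + y * + y) (subst q∣_ (factor a (+ x * + x) (+ y * + y)) q∣ax²-ay²)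
        where factor : ∀ a u v → a * u - a * v ≡ a * (u - v)
              factor = solve-∀
      ... | inj₁ q∣a       = ⊥-elim (q∤a q∣a)
      ... | inj₂ q∣x²-y²   = squares-distinct 1≤x x≤h y≤h q∣x²-y²

      slots-apart : ∀ {i j} (s : Slot i) (t : Slot j) → ¬ i ≡ j → Apart (value s) (value t)
      slots-apart (origin i≡0) (origin j≡0) i≢j = ⊥-elim (i≢j (trans i≡0 (sym j≡0)))
      slots-apart (origin _) (square _ 1≤y y≤h _) _ = apart-sym (square≉0 1≤y y≤h)
      slots-apart (origin _) (a-square _ 1≤y y≤h _) _ = apart-sym (a-square≉0 1≤y y≤h)
      slots-apart (origin _) (last _) _ = apart-sym (apart-0 q∤b)
      slots-apart (square _ 1≤x x≤h _) (origin _) _ = square≉0 1≤x x≤h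
      slots-apart (square x 1≤x x≤h refl) (square y _ y≤h refl) x≢y =
        apart λ q∣x²-y² → x≢y (squares-distinct 1≤x x≤h y≤h q∣x²-y²)
      slots-apart (square x _ _ _) (a-square _ 1≤y y≤h _) _ = square≉a-square x 1≤y y≤h
      slots-apart (square x _ _ _) (last _) _ = square≉b x
      slots-apart (a-square _ 1≤x x≤h _) (origin _) _ = a-square≉0 1≤x x≤h
      slots-apart (a-square _ 1≤x x≤h _) (square y _ _ _) _ = apart-sym (square≉a-square y 1≤x x≤h)
      slots-apart (a-square x 1≤x x≤h refl) (a-square y _ y≤h refl) i≢j =
        apart λ q∣ax²-ay² → i≢j (cong (h ℕ.+_) (a-squares-distinct 1≤x x≤h y≤h q∣ax²-ay²))
      slots-apart (a-square x _ _ _) (last _) _ = a-square≉b x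
      slots-apart (last _) (origin _) _ = apart-0 q∤b
      slots-apart (last _) (square x _ _ _) _ = apart-sym (square≉b x)
      slots-apart (last _) (a-square x _ _ _) _ = apart-sym (a-square≉b x)
      slots-apart (last i≡) (last j≡) i≢j = ⊥-elim (i≢j (trans i≡ (sym j≡)))

      slot-value : Fin (suc (suc (h ℕ.+ h))) → ℤ
      slot-value i = value (slot (toℕ i) (toℕ<n i))

      two-slots-congruent : ⊥
      two-slots-congruent with pigeonhole (subst (_< _) (sym q≡1+2h) ℕ.≤-refl) residue
        where residue : Fin (suc (suc (h ℕ.+ h))) → Fin q
              residue i = fromℕ< (n%ℕd<d (slot-value i) q)
      ... | i , j , i<j , rᵢ≡rⱼ =
        incongruent (slots-apart (slot (toℕ i) (toℕ<n i)) (slot (toℕ j) (toℕ<n j)) (ℕ.<⇒≢ i<j))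
          (≡-residue⇒q∣ {slot-value i} {slot-value j}
            (trans (sym (toℕ-fromℕ< _)) (trans (cong toℕ rᵢ≡rⱼ) (toℕ-fromℕ< _))))

  nonsquare*nonsquare : ∀ {a b} → q∤ a → q∤ b → ¬ IsSquare a → ¬ IsSquare b → IsSquare (a * b)
  nonsquare*nonsquare {a} {b} q∤a q∤b a-nonsquare b-nonsquare
    with isSquare? (a * b) | odd-prime q-prime 2<q
  ... | yes ab-square   | _ = ab-square
  ... | no ab-nonsquare | h , q≡1+2h =
    ⊥-elim (Pigeonhole.two-slots-congruent h q≡1+2h q∤a q∤b a-nonsquare b-nonsquare ab-nonsquare)

  private
    square-cancel : ∀ r p → q∤ r → IsSquare r → IsSquare (r * p) → IsSquare p
    square-cancel r p q∤r (t , q∣t²-r) rp-square =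
      square-unscale (r * p) t p (q∤-root r t q∤r q∣t²-r) (q∣-lincomb₁ (- p) (identity r p t) q∣t²-r) rp-square
      where identity : ∀ r p t → r * p - t * t * p ≡ - p * (t * t - r)
            identity = solve-∀

  residue-flip : ∀ r r′ l p → q∣ (r′ - l * l * (r * p)) → q∤ l → q∤ r → q∤ r′ →
                 q∤ p → ¬ IsSquare p → does (residue? r) ≢ does (residue? r′)
  residue-flip r r′ l p q∣r′-l²rp q∤l q∤r q∤r′ q∤p p-nonsquare with residue? r | residue? r′
  ... | yes (_ , r-square) | yes (_ , r′-square) = λ _ → p-nonsquare
          (square-cancel r p q∤r r-square (square-unscale r′ l (r * p) q∤l q∣r′-l²rp r′-square))
  ... | no r-nonresidue | no r′-nonresidue = λ _ → r′-nonresidue (q∤r′ ,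
          square-scale r′ l (r * p) q∣r′-l²rp
            (nonsquare*nonsquare q∤r q∤p (λ r-square → r-nonresidue (q∤r , r-square)) p-nonsquare))
  ... | yes _ | no _ = λ ()
  ... | no _  | yes _ = λ ()

module ProjectiveMatrices (q : ℕ) (q-prime : Prime q) where
  open PrimeField q q-prime

  Scaled : ℤ → M2 → M2 → Set
  Scaled l A B = q∣ (m₀₀ A - l * m₀₀ B) × q∣ (m₀₁ A - l * m₀₁ B) ×
                 q∣ (m₁₀ A - l * m₁₀ B) × q∣ (m₁₁ A - l * m₁₁ B)

  infix 4 _≃_
  record _≃_ (A B : M2) : Set where
    constructor scaling
    field
      factor   : ℤ
      factor≢0 : q∤ factor
      scaled   : Scaled factor A B

  ∼⇒≃ : ∀ {A B} → A ∼[ q ] B → A ≃ B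
  ∼⇒≃ {mat a₀ a₁ a₂ a₃} {mat b₀ b₁ b₂ b₃} (l , l≢0 , e₀ , e₁ , e₂ , e₃) =
    scaling l (≢[q]0⇒q∤ l≢0)
      (≡[q]⇒q∣ a₀ (l * b₀) e₀ , ≡[q]⇒q∣ a₁ (l * b₁) e₁ , ≡[q]⇒q∣ a₂ (l * b₂) e₂ , ≡[q]⇒q∣ a₃ (l * b₃) e₃)

  ≃⇒∼ : ∀ {A B} → A ≃ B → A ∼[ q ] B
  ≃⇒∼ {mat a₀ a₁ a₂ a₃} {mat b₀ b₁ b₂ b₃} (scaling l l≢0 (e₀ , e₁ , e₂ , e₃)) =
    l , q∤⇒≢[q]0 l≢0 ,
    q∣⇒≡[q] a₀ (l * b₀) e₀ , q∣⇒≡[q] a₁ (l * b₁) e₁ , q∣⇒≡[q] a₂ (l * b₂) e₂ , q∣⇒≡[q] a₃ (l * b₃) e₃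

  mat-cong : ∀ {a b c d a′ b′ c′ d′} → a ≡ a′ → b ≡ b′ → c ≡ c′ → d ≡ d′ → mat a b c d ≡ mat a′ b′ c′ d′
  mat-cong refl refl refl refl = refl

  ≃-entrywise : ∀ {a b c d a′ b′ c′ d′} → q∣ (a - a′) → q∣ (b - b′) → q∣ (c - c′) → q∣ (d - d′) →
                mat a b c d ≃ mat a′ b′ c′ d′
  ≃-entrywise {a} {b} {c} {d} {a′} {b′} {c′} {d′} e₀ e₁ e₂ e₃ =
    scaling 1ℤ q∤1 (unit a a′ e₀ , unit b b′ e₁ , unit c c′ e₂ , unit d d′ e₃)
    where unit : ∀ a a′ → q∣ (a - a′) → q∣ (a - 1ℤ * a′)
          unit a a′ = subst (λ t → q∣ (a - t)) (sym (Int.*-identityˡ a′))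

  ≃-refl : ∀ {A} → A ≃ A
  ≃-refl {mat a b c d} = ≃-entrywise (q∣-refl a) (q∣-refl b) (q∣-refl c) (q∣-refl d)

  ≃-sym : ∀ {A B} → A ≃ B → B ≃ A
  ≃-sym {mat a₀ a₁ a₂ a₃} {mat b₀ b₁ b₂ b₃} (scaling l l≢0 (e₀ , e₁ , e₂ , e₃)) with inverse l≢0
  ... | l⁻¹ , q∣ll⁻¹-1 =
    scaling l⁻¹ (q∤-inverse l l⁻¹ q∣ll⁻¹-1) (flip a₀ b₀ e₀ , flip a₁ b₁ e₁ , flip a₂ b₂ e₂ , flip a₃ b₃ e₃)
    where
      flip : ∀ a b → q∣ (a - l * b) → q∣ (b - l⁻¹ * a)
      flip a b = q∣-lincomb₂ (- b) (- l⁻¹) (identity a b l l⁻¹) q∣ll⁻¹-1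
        where identity : ∀ a b l i → b - i * a ≡ - b * (l * i - 1ℤ) + - i * (a - l * b)
              identity = solve-∀

  ≃-trans : ∀ {A B C} → A ≃ B → B ≃ C → A ≃ C
  ≃-trans {mat a₀ a₁ a₂ a₃} {mat b₀ b₁ b₂ b₃} {mat c₀ c₁ c₂ c₃}
    (scaling l l≢0 (e₀ , e₁ , e₂ , e₃)) (scaling m m≢0 (f₀ , f₁ , f₂ , f₃)) =
    scaling (l * m) (q∤-* l≢0 m≢0)
      (compose a₀ b₀ c₀ e₀ f₀ , compose a₁ b₁ c₁ e₁ f₁ , compose a₂ b₂ c₂ e₂ f₂ , compose a₃ b₃ c₃ e₃ f₃)
    where compose : ∀ a b c → q∣ (a - l * b) → q∣ (b - m * c) → q∣ (a - l * m * c)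
          compose a b c = q∣-lincomb₂ 1ℤ l (identity a b c l m)
            where identity : ∀ a b c l m → a - l * m * c ≡ 1ℤ * (a - l * b) + l * (b - m * c)
                  identity = solve-∀

  ≃-isEquivalence : IsEquivalence _≃_
  ≃-isEquivalence = record { refl = ≃-refl ; sym = ≃-sym ; trans = ≃-trans }

  ≃-setoid : Setoid _ _
  ≃-setoid = record { isEquivalence = ≃-isEquivalence }

  module ≃-Reasoning = SetoidReasoning ≃-setoid

  ≡⇒≃ : ∀ {A B} → A ≡ B → A ≃ B
  ≡⇒≃ refl = ≃-refl

  ⊗-cong : ∀ {A A′ B B′} → A ≃ A′ → B ≃ B′ → A ⊗ B ≃ A′ ⊗ B′
  ⊗-cong {mat a₀ a₁ a₂ a₃} {mat a₀′ a₁′ a₂′ a₃′} {mat b₀ b₁ b₂ b₃} {mat b₀′ b₁′ b₂′ b₃′}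
    (scaling l l≢0 (e₀ , e₁ , e₂ , e₃)) (scaling m m≢0 (f₀ , f₁ , f₂ , f₃)) =
    scaling (l * m) (q∤-* l≢0 m≢0)
      ( entry a₀ a₁ b₀ b₂ a₀′ a₁′ b₀′ b₂′ e₀ f₀ e₁ f₂ , entry a₀ a₁ b₁ b₃ a₀′ a₁′ b₁′ b₃′ e₀ f₁ e₁ f₃
      , entry a₂ a₃ b₀ b₂ a₂′ a₃′ b₀′ b₂′ e₂ f₀ e₃ f₂ , entry a₂ a₃ b₁ b₃ a₂′ a₃′ b₁′ b₃′ e₂ f₁ e₃ f₃ )
    where
      entry : ∀ a b c d a′ b′ c′ d′ → q∣ (a - l * a′) → q∣ (c - m * c′) →
              q∣ (b - l * b′) → q∣ (d - m * d′) →
              q∣ (a * c + b * d - l * m * (a′ * c′ + b′ * d′))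
      entry a b c d a′ b′ c′ d′ =
        q∣-lincomb₄ c (l * a′) d (l * b′) (identity a b c d a′ b′ c′ d′ l m)
        where identity : ∀ a b c d a′ b′ c′ d′ l m →
                a * c + b * d - l * m * (a′ * c′ + b′ * d′) ≡
                c * (a - l * a′) + l * a′ * (c - m * c′) + d * (b - l * b′) + l * b′ * (d - m * d′)
              identity = solve-∀

  ⊗-congˡ : ∀ G {A B} → A ≃ B → G ⊗ A ≃ G ⊗ B
  ⊗-congˡ G = ⊗-cong (≃-refl {G})

  ⊗-assoc : ∀ A B C → (A ⊗ B) ⊗ C ≡ A ⊗ (B ⊗ C)
  ⊗-assoc (mat a₀ a₁ a₂ a₃) (mat b₀ b₁ b₂ b₃) (mat c₀ c₁ c₂ c₃) =
    mat-cong (row a₀ a₁ c₀ c₂) (row a₀ a₁ c₁ c₃) (row a₂ a₃ c₀ c₂) (row a₂ a₃ c₁ c₃)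
    where
      row : ∀ a b x y → (a * b₀ + b * b₂) * x + (a * b₁ + b * b₃) * y ≡
                        a * (b₀ * x + b₁ * y) + b * (b₂ * x + b₃ * y)
      row a b x y = identity a b b₀ b₁ b₂ b₃ x y
        where identity : ∀ a b c d e f x y → (a * c + b * e) * x + (a * d + b * f) * y ≡
                                              a * (c * x + d * y) + b * (e * x + f * y)
              identity = solve-∀

  I : M2
  I = mat 1ℤ 0ℤ 0ℤ 1ℤ

  ⊗-identityˡ : ∀ A → I ⊗ A ≡ A
  ⊗-identityˡ (mat a b c d) = mat-cong (identity a c) (identity b d) (identity′ a c) (identity′ b d)
    where identity : ∀ a c → 1ℤ * a + 0ℤ * c ≡ a
          identity = solve-∀
          identity′ : ∀ a c → 0ℤ * a + 1ℤ * c ≡ c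
          identity′ = solve-∀

  ⊗-identityʳ : ∀ A → A ⊗ I ≡ A
  ⊗-identityʳ (mat a b c d) = mat-cong (identity a b) (identity′ a b) (identity c d) (identity′ c d)
    where identity : ∀ a b → a * 1ℤ + b * 0ℤ ≡ a
          identity = solve-∀
          identity′ : ∀ a b → a * 0ℤ + b * 1ℤ ≡ b
          identity′ = solve-∀

  det-⊗ : ∀ A B → det (A ⊗ B) ≡ det A * det B
  det-⊗ (mat a b c d) (mat e f g h) = identity a b c d e f g h
    where identity : ∀ a b c d e f g h →
            (a * e + b * g) * (c * f + d * h) - (a * f + b * h) * (c * e + d * g) ≡
            (a * d - b * c) * (e * h - f * g)
          identity = solve-∀

  det-≃ : ∀ {A B} (A≃B : A ≃ B) → let l = _≃_.factor A≃B in q∣ (det A - l * l * det B)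
  det-≃ {mat a₀ a₁ a₂ a₃} {mat b₀ b₁ b₂ b₃} (scaling l _ (e₀ , e₁ , e₂ , e₃)) =
    q∣-lincomb₄ a₃ (l * b₀) (- a₂) (- (l * b₁)) (identity a₀ a₁ a₂ a₃ b₀ b₁ b₂ b₃ l) e₀ e₃ e₁ e₂
    where identity : ∀ a₀ a₁ a₂ a₃ b₀ b₁ b₂ b₃ l →
            a₀ * a₃ - a₁ * a₂ - l * l * (b₀ * b₃ - b₁ * b₂) ≡
            a₃ * (a₀ - l * b₀) + l * b₀ * (a₃ - l * b₃) + - a₂ * (a₁ - l * b₁) + - (l * b₁) * (a₂ - l * b₂)
          identity = solve-∀

  det-residue-≃ : ∀ {A B} → A ≃ B → IsResidue (det B) → IsResidue (det A)
  det-residue-≃ {A} {B} A≃B = residue-scale (det A) (factor A≃B) (det B) (det-≃ A≃B) (factor≢0 A≃B)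
    where open _≃_

  PSL-resp-≃ : ∀ {A B} → A ≃ B → InPSL q B → InPSL q A
  PSL-resp-≃ A≃B B∈PSL = IsResidue⇒QR (det-residue-≃ A≃B (QR⇒IsResidue B∈PSL))

  PSL-⊗ : ∀ {A B} → InPSL q A → InPSL q B → InPSL q (A ⊗ B)
  PSL-⊗ {A} {B} A∈PSL B∈PSL = subst (λ r → QR r q) (sym (det-⊗ A B))
    (IsResidue⇒QR (residue-* (QR⇒IsResidue A∈PSL) (QR⇒IsResidue B∈PSL)))

  det≡1⇒PSL : ∀ A → det A ≡ 1ℤ → InPSL q A
  det≡1⇒PSL A det≡1 = subst (λ r → QR r q) (sym det≡1) (IsResidue⇒QR (q∤1 , 1ℤ , q∣-multiple 0ℤ))

module PGLBipartition (q : ℕ) (q-prime : Prime q) (2<q : 2 < q) where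
  open PrimeField q q-prime
  open QuadraticResidues q q-prime 2<q
  open ProjectiveMatrices q q-prime

  colour : M2 → Bool
  colour A = does (residue? (det A))

  colour-resp-≃ : ∀ {A B} → A ≃ B → colour A ≡ colour B
  colour-resp-≃ {A} {B} A≃B =
    does-⇔ (mk⇔ (det-residue-≃ (≃-sym A≃B)) (det-residue-≃ A≃B)) (residue? (det A)) (residue? (det B))

  colour-flip : ∀ {A B s p} → InPGL q A → InPGL q B → q∣ (det s - p) → q∤ p → ¬ IsSquare p →
                B ≃ A ⊗ s → colour A ≢ colour B
  colour-flip {A} {B} {s} {p} A∈PGL B∈PGL q∣dets-p q∤p p-nonsquare B≃As =
    residue-flip (det A) (det B) l p q∣detB-l²detAp (_≃_.factor≢0 B≃As)
      (≢[q]0⇒q∤ A∈PGL) (≢[q]0⇒q∤ B∈PGL) q∤p p-nonsquare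
    where
      l : ℤ
      l = _≃_.factor B≃As
      q∣detB-l²detAp : q∣ (det B - l * l * (det A * p))
      q∣detB-l²detAp = q∣-lincomb₂ 1ℤ (l * l * det A) (identity (det B) l (det A) (det s) p)
        (subst (λ d → q∣ (det B - l * l * d)) (det-⊗ A s) (det-≃ B≃As)) q∣dets-p
        where identity : ∀ b l a d p → b - l * l * (a * p) ≡
                           1ℤ * (b - l * l * (a * d)) + l * l * a * (d - p)
              identity = solve-∀

  PGL-bipartite : ∀ {p} (S : List M2) → (∀ {s} → s ∈ S → q∣ (det s - p)) → q∤ p → ¬ IsSquare p →
                  Bipartite q (InPGL q) S
  PGL-bipartite S det≡p q∤p p-nonsquare =
    colour , (λ A B _ _ A∼B → colour-resp-≃ (∼⇒≃ {A} {B} A∼B)) , adjacent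
    where
      adjacent : ∀ A B → InPGL q A → InPGL q B → Adj q S A B → colour A ≢ colour B
      adjacent A B A∈PGL B∈PGL (s , s∈S , inj₁ B∼As) =
        colour-flip {A} {B} A∈PGL B∈PGL (det≡p s∈S) q∤p p-nonsquare (∼⇒≃ {B} {A ⊗ s} B∼As)
      adjacent A B A∈PGL B∈PGL (s , s∈S , inj₂ A∼Bs) =
        colour-flip {B} {A} B∈PGL A∈PGL (det≡p s∈S) q∤p p-nonsquare (∼⇒≃ {A} {B ⊗ s} A∼Bs) ∘ sym

module PSLGeneration (q : ℕ) (q-prime : Prime q) (2<q : 2 < q) where
  open PrimeField q q-prime
  open ProjectiveMatrices q q-prime

  U L : ℤ → M2
  U z = mat 1ℤ z 0ℤ 1ℤ
  L z = mat 1ℤ 0ℤ z 1ℤ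

  data ProductOfSquares : M2 → Set where
    square  : ∀ u → InPSL q u → ProductOfSquares (u ⊗ u)
    _⊗ₛ_    : ∀ {A B} → ProductOfSquares A → ProductOfSquares B → ProductOfSquares (A ⊗ B)
    resp-≃  : ∀ {A B} → A ≃ B → ProductOfSquares B → ProductOfSquares A

  ProductOfSquares⇒PSL : ∀ {A} → ProductOfSquares A → InPSL q A
  ProductOfSquares⇒PSL (square u u∈PSL)         = PSL-⊗ {u} {u} u∈PSL u∈PSL
  ProductOfSquares⇒PSL (_⊗ₛ_ {A} {B} PA PB) = PSL-⊗ {A} {B} (ProductOfSquares⇒PSL PA) (ProductOfSquares⇒PSL PB)
  ProductOfSquares⇒PSL (resp-≃ A≃B PB)      = PSL-resp-≃ A≃B (ProductOfSquares⇒PSL PB)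

  ½ : ℤ
  ½ = proj₁ (inverse (q∤-small (ℕ.s≤s ℕ.z≤n) 2<q))

  halves : ∀ w → q∣ (½ * w + ½ * w - w)
  halves w = q∣-lincomb₁ w (identity ½ w) (proj₂ (inverse (q∤-small (ℕ.s≤s ℕ.z≤n) 2<q)))
    where identity : ∀ h w → h * w + h * w - w ≡ w * (+ 2 * h - 1ℤ)
          identity = solve-∀

  U-+ : ∀ x y → U x ⊗ U y ≡ U (x + y)
  U-+ x y = mat-cong (identity₁ x y) (identity₂ x y) (identity₀ x y) (identity₁′ x y)
    where identity₁ : ∀ x y → 1ℤ * 1ℤ + x * 0ℤ ≡ 1ℤ
          identity₁ = solve-∀
          identity₂ : ∀ x y → 1ℤ * y + x * 1ℤ ≡ x + y
          identity₂ = solve-∀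
          identity₀ : ∀ x y → 0ℤ * 1ℤ + 1ℤ * 0ℤ ≡ 0ℤ
          identity₀ = solve-∀
          identity₁′ : ∀ x y → 0ℤ * y + 1ℤ * 1ℤ ≡ 1ℤ
          identity₁′ = solve-∀

  L-+ : ∀ x y → L x ⊗ L y ≡ L (x + y)
  L-+ x y = mat-cong (identity₁ x y) (identity₀ x y) (identity₂ x y) (identity₁′ x y)
    where identity₁ : ∀ x y → 1ℤ * 1ℤ + 0ℤ * y ≡ 1ℤ
          identity₁ = solve-∀
          identity₀ : ∀ x y → 1ℤ * 0ℤ + 0ℤ * 1ℤ ≡ 0ℤ
          identity₀ = solve-∀
          identity₂ : ∀ x y → x * 1ℤ + 1ℤ * y ≡ x + y
          identity₂ = solve-∀
          identity₁′ : ∀ x y → x * 0ℤ + 1ℤ * 1ℤ ≡ 1ℤ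
          identity₁′ = solve-∀

  det-U : ∀ z → det (U z) ≡ 1ℤ
  det-U = identity
    where identity : ∀ z → 1ℤ * 1ℤ - z * 0ℤ ≡ 1ℤ
          identity = solve-∀

  det-L : ∀ z → det (L z) ≡ 1ℤ
  det-L = identity
    where identity : ∀ z → 1ℤ * 1ℤ - 0ℤ * z ≡ 1ℤ
          identity = solve-∀

  U-square : ∀ w → ProductOfSquares (U w)
  U-square w = resp-≃ U≃½U² (square (U (½ * w)) (det≡1⇒PSL (U (½ * w)) (det-U (½ * w))))
    where
      U≃½U² : U w ≃ U (½ * w) ⊗ U (½ * w)
      U≃½U² = ≃-sym (≃-trans (≡⇒≃ (U-+ (½ * w) (½ * w)))
                (≃-entrywise (q∣-refl 1ℤ) (halves w) (q∣-refl 0ℤ) (q∣-refl 1ℤ)))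

  L-square : ∀ w → ProductOfSquares (L w)
  L-square w = resp-≃ L≃½L² (square (L (½ * w)) (det≡1⇒PSL (L (½ * w)) (det-L (½ * w))))
    where
      L≃½L² : L w ≃ L (½ * w) ⊗ L (½ * w)
      L≃½L² = ≃-sym (≃-trans (≡⇒≃ (L-+ (½ * w) (½ * w)))
                (≃-entrywise (q∣-refl 1ℤ) (q∣-refl 0ℤ) (halves w) (q∣-refl 1ℤ)))

  U-L-U : ∀ x c y → U x ⊗ (L c ⊗ U y) ≡ mat (1ℤ + x * c) (y + x * (c * y + 1ℤ)) c (c * y + 1ℤ)
  U-L-U x c y = mat-cong (identity₀₀ x c y) (identity₀₁ x c y) (identity₁₀ x c y) (identity₁₁ x c y)
    where
      identity₀₀ : ∀ x c y → 1ℤ * (1ℤ * 1ℤ + 0ℤ * 0ℤ) + x * (c * 1ℤ + 1ℤ * 0ℤ) ≡ 1ℤ + x * c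
      identity₀₀ = solve-∀
      identity₀₁ : ∀ x c y → 1ℤ * (1ℤ * y + 0ℤ * 1ℤ) + x * (c * y + 1ℤ * 1ℤ) ≡ y + x * (c * y + 1ℤ)
      identity₀₁ = solve-∀
      identity₁₀ : ∀ x c y → 0ℤ * (1ℤ * 1ℤ + 0ℤ * 0ℤ) + 1ℤ * (c * 1ℤ + 1ℤ * 0ℤ) ≡ c
      identity₁₀ = solve-∀
      identity₁₁ : ∀ x c y → 0ℤ * (1ℤ * y + 0ℤ * 1ℤ) + 1ℤ * (c * y + 1ℤ * 1ℤ) ≡ c * y + 1ℤ
      identity₁₁ = solve-∀

  det-one-factorisation : ∀ {a b c e} → q∤ c → q∣ (a * e - b * c - 1ℤ) → ProductOfSquares (mat a b c e)
  det-one-factorisation {a} {b} {c} {e} q∤c q∣det-1 with inverse q∤c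
  ... | c⁻¹ , q∣cc⁻¹-1 = resp-≃ M≃ULU (U-square x ⊗ₛ (L-square c ⊗ₛ U-square y))
    where
      x y : ℤ
      x = (a - 1ℤ) * c⁻¹
      y = (e - 1ℤ) * c⁻¹
      q∣₀₀ : q∣ (1ℤ + x * c - a)
      q∣₀₀ = q∣-lincomb₁ (a - 1ℤ) (identity a c c⁻¹) q∣cc⁻¹-1
        where identity : ∀ a c i → 1ℤ + (a - 1ℤ) * i * c - a ≡ (a - 1ℤ) * (c * i - 1ℤ)
              identity = solve-∀
      q∣₀₁ : q∣ (y + x * (c * y + 1ℤ) - b)
      q∣₀₁ = q∣-lincomb₂ ((a - 1ℤ) * (e - 1ℤ) * c⁻¹ + b) c⁻¹ (identity a b c e c⁻¹) q∣cc⁻¹-1 q∣det-1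
        where identity : ∀ a b c e i →
                (e - 1ℤ) * i + (a - 1ℤ) * i * (c * ((e - 1ℤ) * i) + 1ℤ) - b ≡
                ((a - 1ℤ) * (e - 1ℤ) * i + b) * (c * i - 1ℤ) + i * (a * e - b * c - 1ℤ)
              identity = solve-∀
      q∣₁₁ : q∣ (c * y + 1ℤ - e)
      q∣₁₁ = q∣-lincomb₁ (e - 1ℤ) (identity c e c⁻¹) q∣cc⁻¹-1
        where identity : ∀ c e i → c * ((e - 1ℤ) * i) + 1ℤ - e ≡ (e - 1ℤ) * (c * i - 1ℤ)
              identity = solve-∀
      M≃ULU : mat a b c e ≃ U x ⊗ (L c ⊗ U y)
      M≃ULU = ≃-sym (≃-trans (≡⇒≃ (U-L-U x c y)) (≃-entrywise q∣₀₀ q∣₀₁ (q∣-refl c) q∣₁₁))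

  PSL-factorisation : ∀ {A} → InPSL q A → q∤ (m₁₀ A) → ProductOfSquares A
  PSL-factorisation {mat a b c e} A∈PSL q∤c with QR⇒IsResidue A∈PSL
  ... | q∤det , t , q∣t²-det with inverse (q∤-root (det (mat a b c e)) t q∤det q∣t²-det)
  ... | t⁻¹ , q∣tt⁻¹-1 =
    resp-≃ A≃t⁻¹A (det-one-factorisation (q∤-* (q∤-inverse t t⁻¹ q∣tt⁻¹-1) q∤c) q∣det′-1)
    where
      A≃t⁻¹A : mat a b c e ≃ mat (t⁻¹ * a) (t⁻¹ * b) (t⁻¹ * c) (t⁻¹ * e)
      A≃t⁻¹A = scaling t (q∤-root (det (mat a b c e)) t q∤det q∣t²-det)
                 (unscale a , unscale b , unscale c , unscale e)
        where unscale : ∀ z → q∣ (z - t * (t⁻¹ * z))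
              unscale z = q∣-lincomb₁ (- z) (identity z t t⁻¹) q∣tt⁻¹-1
                where identity : ∀ z t i → z - t * (i * z) ≡ - z * (t * i - 1ℤ)
                      identity = solve-∀
      q∣det′-1 : q∣ (t⁻¹ * a * (t⁻¹ * e) - t⁻¹ * b * (t⁻¹ * c) - 1ℤ)
      q∣det′-1 = q∣-lincomb₂ (- (t⁻¹ * t⁻¹)) (t * t⁻¹ + 1ℤ) (identity a b c e t t⁻¹) q∣t²-det q∣tt⁻¹-1
        where identity : ∀ a b c e t i → i * a * (i * e) - i * b * (i * c) - 1ℤ ≡
                           - (i * i) * (t * t - (a * e - b * c)) + (t * i + 1ℤ) * (t * i - 1ℤ)
              identity = solve-∀

  PSL⇒ProductOfSquares : ∀ {A} → InPSL q A → ProductOfSquares A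
  PSL⇒ProductOfSquares {A@(mat a b c e)} A∈PSL with q∣? c
  ... | no q∤c  = PSL-factorisation {A} A∈PSL q∤c
  ... | yes q∣c = resp-≃ (≡⇒≃ (sym L⁻¹LA≡A))
      (L-square (- 1ℤ) ⊗ₛ PSL-factorisation {L 1ℤ ⊗ A} (PSL-⊗ {L 1ℤ} {A} (det≡1⇒PSL (L 1ℤ) refl) A∈PSL) q∤a+c)
    where
      q∤a+c : q∤ (1ℤ * a + 1ℤ * c)
      q∤a+c q∣a+c = proj₁ (QR⇒IsResidue A∈PSL)
        (q∣-lincomb₂ e (- b - e) (identity a b c e) q∣a+c q∣c)
        where identity : ∀ a b c e → a * e - b * c ≡ e * (1ℤ * a + 1ℤ * c) + (- b - e) * c
              identity = solve-∀
      L⁻¹LA≡A : L (- 1ℤ) ⊗ (L 1ℤ ⊗ A) ≡ A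
      L⁻¹LA≡A = begin
        L (- 1ℤ) ⊗ (L 1ℤ ⊗ A)   ≡⟨ sym (⊗-assoc (L (- 1ℤ)) (L 1ℤ) A) ⟩
        (L (- 1ℤ) ⊗ L 1ℤ) ⊗ A   ≡⟨ cong (_⊗ A) (L-+ (- 1ℤ) 1ℤ) ⟩
        I ⊗ A                   ≡⟨ ⊗-identityˡ A ⟩
        A                       ∎
        where open ≡-Reasoning

module PSLColouring (q : ℕ) (q-prime : Prime q) (2<q : 2 < q) (S : List M2) where
  open PrimeField q q-prime
  open ProjectiveMatrices q q-prime
  open PSLGeneration q q-prime 2<q

  private
    xor-cancel : ∀ x y z → x xor y ≡ y xor z → x ≡ z
    xor-cancel false false false _ = refl
    xor-cancel false true  false _ = refl
    xor-cancel true  false true  _ = refl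
    xor-cancel true  true  true  _ = refl
    xor-cancel false false true  ()
    xor-cancel false true  true  ()
    xor-cancel true  false false ()
    xor-cancel true  true  false ()

    xor-both-flipped : ∀ {x x′ y y′} → x ≢ x′ → y ≢ y′ → x′ xor y′ ≡ x xor y
    xor-both-flipped {x} {x′} {y} {y′} x≢x′ y≢y′ = begin
      x′ xor y′             ≡⟨ cong₂ _xor_ (¬-not (x≢x′ ∘ sym)) (¬-not (y≢y′ ∘ sym)) ⟩
      not x xor not y       ≡⟨ sym (not-distribˡ-xor x (not y)) ⟩
      not (x xor not y)     ≡⟨ cong not (sym (not-distribʳ-xor x y)) ⟩
      not (not (x xor y))   ≡⟨ not-involutive (x xor y) ⟩
      x xor y               ∎
      where open ≡-Reasoning

  adj-⊗ˡ : ∀ G {A B} → Adj q S A B → Adj q S (G ⊗ A) (G ⊗ B)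
  adj-⊗ˡ G {A} {B} (s , s∈S , inj₁ B∼As) = s , s∈S , inj₁ (≃⇒∼ {G ⊗ B} {(G ⊗ A) ⊗ s} (begin
    G ⊗ B          ≈⟨ ⊗-congˡ G (∼⇒≃ {B} {A ⊗ s} B∼As) ⟩
    G ⊗ (A ⊗ s)    ≡⟨ sym (⊗-assoc G A s) ⟩
    (G ⊗ A) ⊗ s    ∎))
    where open ≃-Reasoning
  adj-⊗ˡ G {A} {B} (s , s∈S , inj₂ A∼Bs) = s , s∈S , inj₂ (≃⇒∼ {G ⊗ A} {(G ⊗ B) ⊗ s} (begin
    G ⊗ A          ≈⟨ ⊗-congˡ G (∼⇒≃ {A} {B ⊗ s} A∼Bs) ⟩
    G ⊗ (B ⊗ s)    ≡⟨ sym (⊗-assoc G B s) ⟩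
    (G ⊗ B) ⊗ s    ∎))
    where open ≃-Reasoning

  module _ (c : M2 → Bool)
           (c-resp : ∀ A B → InPSL q A → InPSL q B → A ∼[ q ] B → c A ≡ c B)
           (c-proper : ∀ A B → InPSL q A → InPSL q B → Adj q S A B → c A ≢ c B)
           (connected : Connected q (InPSL q) S) where

    c-resp-≃ : ∀ {A B} → InPSL q A → InPSL q B → A ≃ B → c A ≡ c B
    c-resp-≃ {A} {B} A∈PSL B∈PSL A≃B = c-resp A B A∈PSL B∈PSL (≃⇒∼ A≃B)

    -- Left multiplication by G preserves adjacency, so along a path from A
    -- it flips colours either at every vertex or at none.
    translate-path : ∀ {G A B} → InPSL q G → InPSL q A → Reach q (InPSL q) S A B →
                     InPSL q B × (c (G ⊗ B) xor c B ≡ c (G ⊗ A) xor c A)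
    translate-path {G} {A} {B} G∈PSL A∈PSL (base A∼B) =
      B∈PSL , cong₂ _xor_ (c-resp-≃ (PSL-⊗ {G} {B} G∈PSL B∈PSL) (PSL-⊗ {G} {A} G∈PSL A∈PSL) (⊗-congˡ G B≃A))
                          (c-resp-≃ B∈PSL A∈PSL B≃A)
      where
        B≃A : B ≃ A
        B≃A = ≃-sym (∼⇒≃ {A} {B} A∼B)
        B∈PSL : InPSL q B
        B∈PSL = PSL-resp-≃ B≃A A∈PSL
    translate-path {G} {A} G∈PSL A∈PSL (step {B} {C} path C∈PSL B—C)
      with translate-path {G} {A} G∈PSL A∈PSL path
    ... | B∈PSL , invariant = C∈PSL , trans (xor-both-flipped
            (c-proper (G ⊗ B) (G ⊗ C) (PSL-⊗ {G} {B} G∈PSL B∈PSL) (PSL-⊗ {G} {C} G∈PSL C∈PSL) (adj-⊗ˡ G B—C))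
            (c-proper B C B∈PSL C∈PSL B—C)) invariant

    colour-translate : ∀ {G A} → InPSL q G → InPSL q A → c (G ⊗ A) xor c A ≡ c G xor c I
    colour-translate {G} {A} G∈PSL A∈PSL =
      trans (proj₂ (translate-path {G} {I} G∈PSL I∈PSL (connected I A I∈PSL A∈PSL)))
            (cong (_xor c I) (c-resp-≃ (PSL-⊗ {G} {I} G∈PSL I∈PSL) G∈PSL (≡⇒≃ (⊗-identityʳ G))))
      where I∈PSL : InPSL q I
            I∈PSL = det≡1⇒PSL I refl

    colour-ProductOfSquares : ∀ {A} → ProductOfSquares A → c A ≡ c I
    colour-ProductOfSquares (square u u∈PSL) =
      xor-cancel (c (u ⊗ u)) (c u) (c I) (colour-translate u∈PSL u∈PSL)
    colour-ProductOfSquares (_⊗ₛ_ {A} {B} PA PB) = xor-cancel (c (A ⊗ B)) (c I) (c I) (begin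
      c (A ⊗ B) xor c I   ≡⟨ cong (c (A ⊗ B) xor_) (sym (colour-ProductOfSquares PB)) ⟩
      c (A ⊗ B) xor c B   ≡⟨ colour-translate (ProductOfSquares⇒PSL PA) (ProductOfSquares⇒PSL PB) ⟩
      c A xor c I         ≡⟨ cong (_xor c I) (colour-ProductOfSquares PA) ⟩
      c I xor c I         ∎)
      where open ≡-Reasoning
    colour-ProductOfSquares (resp-≃ {B = B} A≃B PB) =
      trans (c-resp-≃ (PSL-resp-≃ A≃B B∈PSL) B∈PSL A≃B) (colour-ProductOfSquares PB)
      where B∈PSL : InPSL q B
            B∈PSL = ProductOfSquares⇒PSL PB

  PSL-not-bipartite : ∀ {s} → s ∈ S → InPSL q s → Connected q (InPSL q) S → ¬ Bipartite q (InPSL q) S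
  PSL-not-bipartite {s} s∈S s∈PSL connected (c , c-resp , c-proper) =
    c-proper I s (det≡1⇒PSL I refl) s∈PSL (s , s∈S , inj₁ (≃⇒∼ {s} {I ⊗ s} (≡⇒≃ (sym (⊗-identityˡ s)))))
      (sym (colour-ProductOfSquares c c-resp c-proper connected (PSL⇒ProductOfSquares {s} s∈PSL)))

module QuaternionGenerators (q : ℕ) (q-prime : Prime q) (x y : ℤ)
                            (q∣x²+y²+1 : PrimeField.q∣_ q q-prime (x * x + y * y + 1ℤ)) where
  open PrimeField q q-prime

  det-φ : ∀ π → q∣ (det (φ x y π) - norm π)
  det-φ (quat a₀ a₁ a₂ a₃) = q∣-lincomb₁ (- (a₁ * a₁ + a₃ * a₃)) (identity x y a₀ a₁ a₂ a₃) q∣x²+y²+1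
    where identity : ∀ x y a₀ a₁ a₂ a₃ →
            (a₀ + a₁ * x + a₃ * y) * (a₀ - a₁ * x - a₃ * y) -
            (- (a₁ * y) + a₂ + a₃ * x) * (- (a₁ * y) - a₂ + a₃ * x) -
            (a₀ * a₀ + a₁ * a₁ + a₂ * a₂ + a₃ * a₃)
            ≡ - (a₁ * a₁ + a₃ * a₃) * (x * x + y * y + 1ℤ)
          identity = solve-∀

  det-generator : ∀ {p D s} → All (InP p) D → s ∈ map (φ x y) D → q∣ (det s - + p)
  det-generator {p} D⊆P s∈S with ∈-map⁻ (φ x y) s∈S
  ... | π , π∈D , refl =
    subst (λ n → q∣ (det (φ x y π) - n)) (proj₁ (proj₂ (All.lookup D⊆P π∈D))) (det-φ π)

lemma6 : (d p q : ℕ) → 10 ≤ d → Prime p → d ≤ p → (d % 2 ≡ 0 → p % 8 ≡ 3) →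
    Prime q → p ^ 8 < q → LogCond d p q →
    (x y : ℤ) → (x * x + y * y + + 1) ≡[ q ] (+ 0) →
    (D : List Quat) → IsD d p D →
    (¬ QR (+ p) q → Bipartite q (InPGL q) (map (φ x y) D)) ×
    (QR (+ p) q → Connected q (InPSL q) (map (φ x y) D) →
    ¬ Bipartite q (InPSL q) (map (φ x y) D))
lemma6 _ _ _ _ _ _ _ _ _ _ _ _ _ [] (_ , () , _)
lemma6 _ p q _ p-prime _ _ q-prime p⁸<q _ x y x²+y²+1≡0 D@(π ∷ _) (_ , _ , D⊆P , _) = PGL-case , PSL-case
  where
    open PrimeField q q-prime
    open ProjectiveMatrices q q-prime
    open QuaternionGenerators q q-prime x y
      (subst q∣_ (Int.+-identityʳ _) (≡[q]⇒q∣ (x * x + y * y + 1ℤ) 0ℤ x²+y²+1≡0))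

    1<p : 1 < p
    1<p = ℕ.nonTrivial⇒n>1 p {{prime⇒nonTrivial p-prime}}

    p<q : p < q
    p<q = ℕ.≤-<-trans (ℕ.m≤m*n p (p ^ 7) {{ℕ.m^n≢0 p 7 {{prime⇒nonZero p-prime}}}}) p⁸<q

    2<q : 2 < q
    2<q = ℕ.≤-<-trans 1<p p<q

    q∤p : q∤ (+ p)
    q∤p = q∤-small (ℕ.<-trans (ℕ.s≤s ℕ.z≤n) 1<p) p<q

    S : List M2
    S = map (φ x y) D

    PGL-case : ¬ QR (+ p) q → Bipartite q (InPGL q) S
    PGL-case p-nonresidue = PGLBipartition.PGL-bipartite q q-prime 2<q S (det-generator D⊆P) q∤p
      (λ p-square → p-nonresidue (IsResidue⇒QR (q∤p , p-square)))

    PSL-case : QR (+ p) q → Connected q (InPSL q) S → ¬ Bipartite q (InPSL q) S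
    PSL-case p-residue = PSLColouring.PSL-not-bipartite q q-prime 2<q S (here refl)
      (IsResidue⇒QR (residue-congruent _ (+ p) (det-generator D⊆P (here refl)) (QR⇒IsResidue p-residue)))
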